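{- Let $\Delta_1\vdash t_1$ and $\Delta_2\vdash t_2$ be sequents and let $S$ be the set with $t_1<_\Lambda t_2\Rightarrow S$. Then for every substitution $\gamma:\Delta_1\to\Delta'$ we have $dist(\Delta'\vdash t_1\gamma,\Delta_2\vdash t_2)\le dist(\Delta_1\vdash t_1,\Delta_2\vdash t_2)$. Moreover, if $\bot\in S$ then $dist(\Delta'\vdash t_1\gamma,\Delta_2\vdash t_2)=dist(\Delta_1\vdash t_1,\Delta_2\vdash t_2)=0$.
   Context: Pseudoterms: $t ::= v \mid s \mid t\,t \mid \lambda v{:}t.t \mid \Pi v{:}t.t$ ($v$ variables, $s$ sorts), with some variables designated as constants $h$ of fixed arity $n$, written $h(t_1,\dots,t_n)$ when applied to $n$ arguments. $|t|$ is the size of $t$ (number of nodes of its syntax tree, $|v|=|s|=1$). Positions are sequences of integers, $\Lambda$ the root, $t|_p$ the subterm at $p$, $\mathrm{head}(t)$ the head symbol. $\mathrm{Var}$ is the set of variables; for a variable environment $\Delta$ (list of declarations $x:T$), "$t\in\Delta$" means $t$ is a variable declared in $\Delta$. A substitution $\gamma:\Delta_1\to\Delta'$ maps the variables of $\Delta_1$ to terms over the variables of $\Delta'$. Splitting matching: given sequents $\Delta_1\vdash t_1$, $\Delta_2\vdash t_2$, the judgment $t_1<_p t_2\Rightarrow S$ is defined by the rules: (1) $\Pi x{:}t_1.t_2<_p\Pi x{:}t'_1.t'_2\Rightarrow S_1\cup S_2$ if $t_1<_{p\cdot1}t'_1\Rightarrow S_1$ and $t_2<_{p\cdot2}t'_2\Rightarrow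 S_2$; (2) the same for $\lambda x{:}t_1.t_2$ vs $\lambda x{:}t'_1.t'_2$; (3) the same for applications $t_1\,t_2$ vs $t'_1\,t'_2$; (4) $h(t_1,\dots,t_n)<_p h(t'_1,\dots,t'_n)\Rightarrow S_1\cup\dots\cup S_n$ if $t_i<_{p\cdot i}t'_i\Rightarrow S_i$, $h$ a constant; (5) if $t_1,t_2\notin\mathrm{Var}$ and $\mathrm{head}(t_1)\neq\mathrm{head}(t_2)$ then $t_1<_p t_2\Rightarrow\{\bot\}$; (6) if $t_1\in\Delta_1$ and $t_2\notin\mathrm{Var}\setminus\Delta_2$ then $t_1<_p t_2\Rightarrow\{p\}$; (7) if ($t_1\in\mathrm{Var}\setminus\Delta_1$ and $t_1=t_2$) or ($t_1\notin\mathrm{Var}$ and $t_2\in\Delta_2$) then $t_1<_pt_2\Rightarrow\emptyset$; (8) if ($t_1\in\mathrm{Var}\setminus\Delta_1$ and $t_1\neq t_2$) or ($t_2\in\mathrm{Var}\setminus\Delta_2$ and $t_1\neq t_2$) then $t_1<_pt_2\Rightarrow\{\bot\}$. The unique $S$ with $t_1<_\Lambda t_2\Rightarrow S$ is a subset of $\{\bot\}\cup\{p\mid t_1|_p\in\Delta_1\}$. Distance: $dist(\Delta_1\vdash t_1,\Delta_2\vdash t_2)=\sum_{p\in S}|t_2|_p|$ if $\bot\notin S$, and $0$ otherwise, where $t_1<_\Lambda t_2\Rightarrow S$. -}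

module Defs where

open import Data.Nat using (ℕ; zero; suc; _+_; _<_; _≡ᵇ_)
open import Data.Nat.Properties using (_≟_)
open import Data.Bool using (Bool; true; false; if_then_else_; _∨_; not)
open import Data.List using (List; []; _∷_; _++_; map)
open import Data.Nat.ListAction using (sum)
open import Data.List.Membership.Propositional using (_∈_)
open import Data.Vec using (Vec; []; _∷_)
open import Data.Maybe using (Maybe; just; nothing; maybe)
open import Data.Product using (_×_; _,_; proj₁)
open import Relation.Binary.PropositionalEquality using (_≡_; refl)
open import Relation.Nullary using (yes; no)

-- Pseudoterms in locally nameless style:
--   fvar x   : a (free, named) variable, possibly declared in an environment
--   bvar i   : a bound variable (de Bruijn index)
--   sort s, application, λ A.B and Π A.B (the body B uses bvar 0 for the binder),
--   con h ts : constant h applied to its ar h arguments, h(t₁,…,tₙ)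
data Term (ar : ℕ → ℕ) : Set where
  fvar : ℕ → Term ar
  bvar : ℕ → Term ar
  sort : ℕ → Term ar
  app  : Term ar → Term ar → Term ar
  lam  : Term ar → Term ar → Term ar
  pi   : Term ar → Term ar → Term ar
  con  : (h : ℕ) → Vec (Term ar) (ar h) → Term ar

variable
  ar : ℕ → ℕ

Env : (ℕ → ℕ) → Set
Env ar = List (ℕ × Term ar)

dom : Env ar → List ℕ
dom Δ = map proj₁ Δ

memb : ℕ → List ℕ → Bool
memb x []       = false
memb x (y ∷ ys) = (x ≡ᵇ y) ∨ memb x ys

mutual
  size : Term ar → ℕ
  size (fvar _)   = 1
  size (bvar _)   = 1
  size (sort _)   = 1
  size (app t u)  = suc (size t + size u)
  size (lam t u)  = suc (size t + size u)
  size (pi t u)   = suc (size t + size u)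
  size (con h ts) = suc (sizes ts)

  sizes : ∀ {n} → Vec (Term ar) n → ℕ
  sizes []       = 0
  sizes (t ∷ ts) = size t + sizes ts

-- Positions (children are numbered from 1) and subterms.
Pos : Set
Pos = List ℕ

mutual
  _at_ : Term ar → Pos → Maybe (Term ar)
  t          at []            = just t
  app t u    at (1 ∷ p)       = t at p
  app t u    at (2 ∷ p)       = u at p
  lam t u    at (1 ∷ p)       = t at p
  lam t u    at (2 ∷ p)       = u at p
  pi t u     at (1 ∷ p)       = t at p
  pi t u     at (2 ∷ p)       = u at p
  con h ts   at (suc i ∷ p)   = vat ts i p
  _          at (_ ∷ _)       = nothing

  vat : ∀ {n} → Vec (Term ar) n → ℕ → Pos → Maybe (Term ar)
  vat []       _       p = nothing
  vat (t ∷ ts) zero    p = t at p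
  vat (t ∷ ts) (suc i) p = vat ts i p

sizeAt : Term ar → Pos → ℕ
sizeAt t p = maybe size 0 (t at p)

-- Result of splitting matching: a set S ⊆ {⊥} ∪ Positions, represented by
-- a flag (⊥ ∈ S) and the list of positions in S.
record MSet : Set where
  constructor mset
  field
    hasBot : Bool
    poss   : List Pos
open MSet public

∅ : MSet
∅ = mset false []

⊥S : MSet
⊥S = mset true []

_∪_ : MSet → MSet → MSet
mset b ps ∪ mset c qs = mset (b ∨ c) (ps ++ qs)

-- t is a variable not declared in Δ (i.e. t ∈ Var ∖ Δ)
outside : List ℕ → Term ar → Bool
outside D (fvar y) = not (memb y D)
outside D (bvar _) = true
outside D _        = false

-- Splitting matching  t₁ <_p t₂ ⇒ S  (relative to Δ₁, Δ₂), as a function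
-- (the rules are syntax directed).
module _ {ar : ℕ → ℕ} (D₁ D₂ : List ℕ) where
  mutual
    -- t₁ a non-variable, t₂ arbitrary
    matchNV : Pos → Term ar → Term ar → MSet
    matchNV p t₁ (fvar y) = if memb y D₂ then ∅ else ⊥S
    matchNV p t₁ (bvar _) = ⊥S
    matchNV p (sort s) (sort s') = if s ≡ᵇ s' then ∅ else ⊥S
    matchNV p (app t u) (app t' u') = match (p ++ (1 ∷ [])) t t' ∪ match (p ++ (2 ∷ [])) u u'
    matchNV p (lam t u) (lam t' u') = match (p ++ (1 ∷ [])) t t' ∪ match (p ++ (2 ∷ [])) u u'
    matchNV p (pi t u)  (pi t' u')  = match (p ++ (1 ∷ [])) t t' ∪ match (p ++ (2 ∷ [])) u u'
    matchNV p (con h ts) (con h' ts') with h ≟ h'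
    ... | yes refl = matchArgs p 1 ts ts'
    ... | no _     = ⊥S
    matchNV p _ _ = ⊥S

    matchArgs : ∀ {n} → Pos → ℕ → Vec (Term ar) n → Vec (Term ar) n → MSet
    matchArgs p i []       []         = ∅
    matchArgs p i (t ∷ ts) (t' ∷ ts') = match (p ++ (i ∷ [])) t t' ∪ matchArgs p (suc i) ts ts'

    match : Pos → Term ar → Term ar → MSet
    match p (fvar x) t₂ with memb x D₁
    ... | true  = if outside D₂ t₂ then ⊥S else mset false (p ∷ [])
    match p (fvar x) (fvar y) | false = if x ≡ᵇ y then ∅ else ⊥S
    match p (fvar x) _        | false = ⊥S
    -- bound variables are never declared in an environment
    match p (bvar i) (bvar j) = if i ≡ᵇ j then ∅ else ⊥S
    match p (bvar i) _        = ⊥S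
    match p t₁ t₂ = matchNV p t₁ t₂

matchΛ : Env ar → Term ar → Env ar → Term ar → MSet
matchΛ Δ₁ t₁ Δ₂ t₂ = match (dom Δ₁) (dom Δ₂) [] t₁ t₂

dist : Env ar → Term ar → Env ar → Term ar → ℕ
dist Δ₁ t₁ Δ₂ t₂ with matchΛ Δ₁ t₁ Δ₂ t₂
... | mset true  _  = 0
... | mset false ps = sum (map (sizeAt t₂) ps)

-- Well-scopedness: all free variables of t are declared in Δ and there are
-- no dangling bound variables (k = number of enclosing binders).
mutual
  data Scoped {ar : ℕ → ℕ} (D : List ℕ) : ℕ → Term ar → Set where
    s-fvar : ∀ {k x} → x ∈ D → Scoped D k (fvar x)
    s-bvar : ∀ {k i} → i < k → Scoped D k (bvar i)
    s-sort : ∀ {k s} → Scoped D k (sort s)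
    s-app  : ∀ {k t u} → Scoped D k t → Scoped D k u → Scoped D k (app t u)
    s-lam  : ∀ {k t u} → Scoped D k t → Scoped D (suc k) u → Scoped D k (lam t u)
    s-pi   : ∀ {k t u} → Scoped D k t → Scoped D (suc k) u → Scoped D k (pi t u)
    s-con  : ∀ {k h ts} → ScopedArgs D k ts → Scoped D k (con h ts)

  data ScopedArgs {ar : ℕ → ℕ} (D : List ℕ) (k : ℕ) : ∀ {n} → Vec (Term ar) n → Set where
    []  : ScopedArgs D k []
    _∷_ : ∀ {n t} {ts : Vec (Term ar) n} → Scoped D k t → ScopedArgs D k ts → ScopedArgs D k (t ∷ ts)

_⊢_ : Env ar → Term ar → Set
Δ ⊢ t = Scoped (dom Δ) 0 t

IsSubst : Env ar → (ℕ → Term ar) → Env ar → Set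
IsSubst Δ₁ γ Δ' = ∀ x → x ∈ dom Δ₁ → Δ' ⊢ γ x

-- t γ : replace each free variable x by γ x (the substituted terms are
-- locally closed, so no capture or shifting issues arise).
mutual
  _[_] : Term ar → (ℕ → Term ar) → Term ar
  fvar x   [ γ ] = γ x
  bvar i   [ γ ] = bvar i
  sort s   [ γ ] = sort s
  app t u  [ γ ] = app (t [ γ ]) (u [ γ ])
  lam t u  [ γ ] = lam (t [ γ ]) (u [ γ ])
  pi t u   [ γ ] = pi (t [ γ ]) (u [ γ ])
  con h ts [ γ ] = con h (substs ts γ)

  substs : ∀ {n} → Vec (Term ar) n → (ℕ → Term ar) → Vec (Term ar) n
  substs []       γ = []
  substs (t ∷ ts) γ = (t [ γ ]) ∷ substs ts γ

-- Substituting γ x for a variable x ∈ Δ₁ of t₁ only changes the matching below the position p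
-- of that occurrence: where x contributed the single position p, of weight |t₂|ₚ|, the term γ x
-- now contributes positions inside t₂|ₚ, which lie in disjoint subtrees and so weigh at most
-- |t₂|ₚ| in total.  Failure (⊥) is preserved: where x meets a variable of t₂ not declared in Δ₂
-- matching fails, and so it does for γ x, which is a declared variable of Δ′ or no variable at all;
-- everywhere else the same rules apply before and after substitution.
module Submission where

open import Defs
open import Data.Nat using (ℕ; zero; suc; _+_; _≤_; z≤n; _≡ᵇ_)
open import Data.Nat.Properties
  using (≤-refl; ≤-reflexive; +-mono-≤; m≤n⇒m≤1+n; +-suc; +-comm; +-identityʳ; ≡⇒≡ᵇ; _≟_)
open import Data.Bool using (true; false; _∨_; if_then_else_)
open import Data.Bool.Properties using (T-≡; ∨-zeroʳ)
open import Data.List using (List; []; _∷_; _++_; map)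
open import Data.List.Properties using (map-++)
open import Data.List.Membership.Propositional using (_∈_)
open import Data.List.Relation.Unary.Any using (here; there)
open import Data.Maybe using (just; _>>=_)
open import Data.Nat.ListAction using (sum)
open import Data.Nat.ListAction.Properties using (sum-++)
open import Data.Product using (_×_; _,_)
open import Data.Vec using (Vec; []; _∷_)
open import Function.Bundles using (Equivalence)
open import Relation.Binary.PropositionalEquality using (_≡_; refl; sym; trans; cong; subst)
open import Relation.Nullary using (yes; no)

mutual
  at-++ : (t : Term ar) (p q : Pos) → t at (p ++ q) ≡ (t at p >>= _at q)
  at-++ t          []                      q = refl
  at-++ (fvar _)   (_ ∷ _)                 q = refl
  at-++ (bvar _)   (_ ∷ _)                 q = refl
  at-++ (sort _)   (_ ∷ _)                 q = refl
  at-++ (app t u)  (0 ∷ p)                 q = refl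
  at-++ (app t u)  (1 ∷ p)                 q = at-++ t p q
  at-++ (app t u)  (2 ∷ p)                 q = at-++ u p q
  at-++ (app t u)  (suc (suc (suc _)) ∷ p) q = refl
  at-++ (lam t u)  (0 ∷ p)                 q = refl
  at-++ (lam t u)  (1 ∷ p)                 q = at-++ t p q
  at-++ (lam t u)  (2 ∷ p)                 q = at-++ u p q
  at-++ (lam t u)  (suc (suc (suc _)) ∷ p) q = refl
  at-++ (pi t u)   (0 ∷ p)                 q = refl
  at-++ (pi t u)   (1 ∷ p)                 q = at-++ t p q
  at-++ (pi t u)   (2 ∷ p)                 q = at-++ u p q
  at-++ (pi t u)   (suc (suc (suc _)) ∷ p) q = refl
  at-++ (con h ts) (0 ∷ p)                 q = refl
  at-++ (con h ts) (suc i ∷ p)             q = vat-++ ts i p q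

  vat-++ : ∀ {n} (ts : Vec (Term ar) n) (i : ℕ) (p q : Pos) →
           vat ts i (p ++ q) ≡ (vat ts i p >>= _at q)
  vat-++ []       i       p q = refl
  vat-++ (t ∷ ts) zero    p q = at-++ t p q
  vat-++ (t ∷ ts) (suc i) p q = vat-++ ts i p q

at-++-just : (t : Term ar) (p q : Pos) {u v : Term ar} →
             t at p ≡ just u → u at q ≡ just v → t at (p ++ q) ≡ just v
at-++-just t p q at-p at-q rewrite at-++ t p q | at-p = at-q

ArgsAt : ∀ {n} → Term ar → Pos → ℕ → Vec (Term ar) n → Set
ArgsAt t p i us = ∀ j → t at (p ++ (j + i) ∷ []) ≡ vat us j []

argsAt-con : ∀ (t : Term ar) p {h us} → t at p ≡ just (con h us) → ArgsAt t p 1 us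
argsAt-con t p at-p j rewrite +-comm j 1 | at-++ t p (suc j ∷ []) | at-p = refl

argsAt-tail : ∀ {n} {t : Term ar} {p i u} {us : Vec (Term ar) n} →
              ArgsAt t p i (u ∷ us) → ArgsAt t p (suc i) us
argsAt-tail {i = i} args j rewrite +-suc j i = args (suc j)

∈⇒memb : ∀ {x xs} → x ∈ xs → memb x xs ≡ true
∈⇒memb {x} (here refl) rewrite Equivalence.to T-≡ (≡⇒≡ᵇ x x refl) = refl
∈⇒memb {x} {y ∷ _} (there x∈) rewrite ∈⇒memb x∈ = ∨-zeroʳ (x ≡ᵇ y)

∨-mono-true : ∀ {a b a′ b′} → (a ≡ true → a′ ≡ true) → (b ≡ true → b′ ≡ true) →
              a ∨ b ≡ true → a′ ∨ b′ ≡ true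
∨-mono-true {true}              f g a∨b = cong (_∨ _) (f refl)
∨-mono-true {false} {a′ = a′} f g b     rewrite g b = ∨-zeroʳ a′

weight : Term ar → MSet → ℕ
weight t S = sum (map (sizeAt t) (poss S))

weight-∪ : (t : Term ar) (S R : MSet) → weight t (S ∪ R) ≡ weight t S + weight t R
weight-∪ t S R = trans (cong sum (map-++ (sizeAt t) (poss S) (poss R)))
                       (sum-++ (map (sizeAt t) (poss S)) (map (sizeAt t) (poss R)))

weight-∪-≤ : ∀ {t : Term ar} (S R : MSet) {m n} →
             weight t S ≤ m → weight t R ≤ n → weight t (S ∪ R) ≤ m + n
weight-∪-≤ {t = t} S R S≤m R≤n = subst (_≤ _) (sym (weight-∪ t S R)) (+-mono-≤ S≤m R≤n)

weight-singleton : ∀ (t : Term ar) p {u} → t at p ≡ just u → weight t (mset false (p ∷ [])) ≡ size u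
weight-singleton t p {u} at-p rewrite at-p = +-identityʳ (size u)

weight-if-∅-⊥S : ∀ {t : Term ar} b {n} → weight t (if b then ∅ else ⊥S) ≤ n
weight-if-∅-⊥S true  = z≤n
weight-if-∅-⊥S false = z≤n

record _≼[_]_ (S : MSet) (t : Term ar) (R : MSet) : Set where
  constructor _,_
  field
    ⊥-reflect : hasBot R ≡ true → hasBot S ≡ true
    weight-≤  : weight t S ≤ weight t R

≼-reflexive : ∀ {t : Term ar} {S R} → S ≡ R → S ≼[ t ] R
≼-reflexive refl = (λ ⊥∈S → ⊥∈S) , ≤-refl

≼-refl : ∀ {t : Term ar} {S} → S ≼[ t ] S
≼-refl = ≼-reflexive refl

∪-mono-≼ : ∀ {t : Term ar} {S S′ R R′} → S ≼[ t ] R → S′ ≼[ t ] R′ → (S ∪ S′) ≼[ t ] (R ∪ R′)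
∪-mono-≼ {t = t} {S} {S′} {R} {R′} (bot , wS) (bot′ , wS′) =
  ∨-mono-true bot bot′ , subst (_ ≤_) (sym (weight-∪ t R R′)) (weight-∪-≤ S S′ wS wS′)

≼-singleton : ∀ (t : Term ar) p {u S} → t at p ≡ just u → weight t S ≤ size u →
              S ≼[ t ] mset false (p ∷ [])
≼-singleton t p {S = S} at-p S≤u = (λ ()) , subst (weight t S ≤_) (sym (weight-singleton t p at-p)) S≤u

distOf : Term ar → MSet → ℕ
distOf t   (mset true  _) = 0
distOf t S@(mset false _) = weight t S

dist≡distOf : (Δ₁ : Env ar) (t₁ : Term ar) (Δ₂ : Env ar) (t₂ : Term ar) →
              dist Δ₁ t₁ Δ₂ t₂ ≡ distOf t₂ (matchΛ Δ₁ t₁ Δ₂ t₂)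
dist≡distOf Δ₁ t₁ Δ₂ t₂ with matchΛ Δ₁ t₁ Δ₂ t₂
... | mset true  _ = refl
... | mset false _ = refl

distOf-⊥ : ∀ {t : Term ar} {S} → hasBot S ≡ true → distOf t S ≡ 0
distOf-⊥ {S = mset true _} refl = refl

distOf-mono-≼ : ∀ {t : Term ar} {S R} → S ≼[ t ] R → distOf t S ≤ distOf t R
distOf-mono-≼ {S = mset true  _} {mset _     _} _        = z≤n
distOf-mono-≼ {S = mset false _} {mset true  _} (bot , _) with bot refl
... | ()
distOf-mono-≼ {S = mset false _} {mset false _} (_ , w) = w

module _ {ar : ℕ → ℕ} (D₂ : List ℕ) where

  mutual
    weight-match-≤-size : ∀ D (t : Term ar) p u t₂ → t at p ≡ just t₂ →
                          weight t (match D D₂ p u t₂) ≤ size t₂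
    weight-match-≤-size D t p (fvar x) t₂ at-p with memb x D
    ... | true with outside D₂ t₂
    ...   | true  = z≤n
    ...   | false = ≤-reflexive (weight-singleton t p at-p)
    weight-match-≤-size D t p (fvar x) (fvar y)  at-p | false = weight-if-∅-⊥S (x ≡ᵇ y)
    weight-match-≤-size D t p (fvar x) (bvar _)  at-p | false = z≤n
    weight-match-≤-size D t p (fvar x) (sort _)  at-p | false = z≤n
    weight-match-≤-size D t p (fvar x) (app _ _) at-p | false = z≤n
    weight-match-≤-size D t p (fvar x) (lam _ _) at-p | false = z≤n
    weight-match-≤-size D t p (fvar x) (pi _ _)  at-p | false = z≤n
    weight-match-≤-size D t p (fvar x) (con _ _) at-p | false = z≤n
    weight-match-≤-size D t p (bvar i) (bvar j)  at-p = weight-if-∅-⊥S (i ≡ᵇ j)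
    weight-match-≤-size D t p (bvar i) (fvar _)  at-p = z≤n
    weight-match-≤-size D t p (bvar i) (sort _)  at-p = z≤n
    weight-match-≤-size D t p (bvar i) (app _ _) at-p = z≤n
    weight-match-≤-size D t p (bvar i) (lam _ _) at-p = z≤n
    weight-match-≤-size D t p (bvar i) (pi _ _)  at-p = z≤n
    weight-match-≤-size D t p (bvar i) (con _ _) at-p = z≤n
    weight-match-≤-size D t p u@(sort _)  t₂ at-p = weight-matchNV-≤-size D t p u t₂ at-p
    weight-match-≤-size D t p u@(app _ _) t₂ at-p = weight-matchNV-≤-size D t p u t₂ at-p
    weight-match-≤-size D t p u@(lam _ _) t₂ at-p = weight-matchNV-≤-size D t p u t₂ at-p
    weight-match-≤-size D t p u@(pi _ _)  t₂ at-p = weight-matchNV-≤-size D t p u t₂ at-p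
    weight-match-≤-size D t p u@(con _ _) t₂ at-p = weight-matchNV-≤-size D t p u t₂ at-p

    weight-matchNV-≤-size : ∀ D (t : Term ar) p u t₂ → t at p ≡ just t₂ →
                            weight t (matchNV D D₂ p u t₂) ≤ size t₂
    weight-matchNV-≤-size D t p u (fvar y) at-p = weight-if-∅-⊥S (memb y D₂)
    weight-matchNV-≤-size D t p u (bvar _) at-p = z≤n
    weight-matchNV-≤-size D t p (sort s) (sort s′) at-p = weight-if-∅-⊥S (s ≡ᵇ s′)
    weight-matchNV-≤-size D t p (app a b) (app a′ b′) at-p =
      m≤n⇒m≤1+n (weight-∪-≤ (match D D₂ _ a a′) (match D D₂ _ b b′)
        (weight-match-≤-size D t (p ++ 1 ∷ []) a a′ (at-++-just t p (1 ∷ []) at-p refl))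
        (weight-match-≤-size D t (p ++ 2 ∷ []) b b′ (at-++-just t p (2 ∷ []) at-p refl)))
    weight-matchNV-≤-size D t p (lam a b) (lam a′ b′) at-p =
      m≤n⇒m≤1+n (weight-∪-≤ (match D D₂ _ a a′) (match D D₂ _ b b′)
        (weight-match-≤-size D t (p ++ 1 ∷ []) a a′ (at-++-just t p (1 ∷ []) at-p refl))
        (weight-match-≤-size D t (p ++ 2 ∷ []) b b′ (at-++-just t p (2 ∷ []) at-p refl)))
    weight-matchNV-≤-size D t p (pi a b) (pi a′ b′) at-p =
      m≤n⇒m≤1+n (weight-∪-≤ (match D D₂ _ a a′) (match D D₂ _ b b′)
        (weight-match-≤-size D t (p ++ 1 ∷ []) a a′ (at-++-just t p (1 ∷ []) at-p refl))
        (weight-match-≤-size D t (p ++ 2 ∷ []) b b′ (at-++-just t p (2 ∷ []) at-p refl)))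
    weight-matchNV-≤-size D t p (con h us) (con h′ us′) at-p with h ≟ h′
    ... | yes refl = m≤n⇒m≤1+n (weight-matchArgs-≤-sizes D t p 1 us us′ (argsAt-con t p at-p))
    ... | no _     = z≤n
    weight-matchNV-≤-size D t p (fvar _)  (sort _)  at-p = z≤n
    weight-matchNV-≤-size D t p (fvar _)  (app _ _) at-p = z≤n
    weight-matchNV-≤-size D t p (fvar _)  (lam _ _) at-p = z≤n
    weight-matchNV-≤-size D t p (fvar _)  (pi _ _)  at-p = z≤n
    weight-matchNV-≤-size D t p (fvar _)  (con _ _) at-p = z≤n
    weight-matchNV-≤-size D t p (bvar _)  (sort _)  at-p = z≤n
    weight-matchNV-≤-size D t p (bvar _)  (app _ _) at-p = z≤n
    weight-matchNV-≤-size D t p (bvar _)  (lam _ _) at-p = z≤n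
    weight-matchNV-≤-size D t p (bvar _)  (pi _ _)  at-p = z≤n
    weight-matchNV-≤-size D t p (bvar _)  (con _ _) at-p = z≤n
    weight-matchNV-≤-size D t p (sort _)  (app _ _) at-p = z≤n
    weight-matchNV-≤-size D t p (sort _)  (lam _ _) at-p = z≤n
    weight-matchNV-≤-size D t p (sort _)  (pi _ _)  at-p = z≤n
    weight-matchNV-≤-size D t p (sort _)  (con _ _) at-p = z≤n
    weight-matchNV-≤-size D t p (app _ _) (sort _)  at-p = z≤n
    weight-matchNV-≤-size D t p (app _ _) (lam _ _) at-p = z≤n
    weight-matchNV-≤-size D t p (app _ _) (pi _ _)  at-p = z≤n
    weight-matchNV-≤-size D t p (app _ _) (con _ _) at-p = z≤n
    weight-matchNV-≤-size D t p (lam _ _) (sort _)  at-p = z≤n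
    weight-matchNV-≤-size D t p (lam _ _) (app _ _) at-p = z≤n
    weight-matchNV-≤-size D t p (lam _ _) (pi _ _)  at-p = z≤n
    weight-matchNV-≤-size D t p (lam _ _) (con _ _) at-p = z≤n
    weight-matchNV-≤-size D t p (pi _ _)  (sort _)  at-p = z≤n
    weight-matchNV-≤-size D t p (pi _ _)  (app _ _) at-p = z≤n
    weight-matchNV-≤-size D t p (pi _ _)  (lam _ _) at-p = z≤n
    weight-matchNV-≤-size D t p (pi _ _)  (con _ _) at-p = z≤n
    weight-matchNV-≤-size D t p (con _ _) (sort _)  at-p = z≤n
    weight-matchNV-≤-size D t p (con _ _) (app _ _) at-p = z≤n
    weight-matchNV-≤-size D t p (con _ _) (lam _ _) at-p = z≤n
    weight-matchNV-≤-size D t p (con _ _) (pi _ _)  at-p = z≤n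

    weight-matchArgs-≤-sizes : ∀ D (t : Term ar) p i {n} (us us′ : Vec (Term ar) n) →
                               ArgsAt t p i us′ → weight t (matchArgs D D₂ p i us us′) ≤ sizes us′
    weight-matchArgs-≤-sizes D t p i []       []         args = z≤n
    weight-matchArgs-≤-sizes D t p i (u ∷ us) (u′ ∷ us′) args =
      weight-∪-≤ (match D D₂ (p ++ i ∷ []) u u′) (matchArgs D D₂ p (suc i) us us′)
        (weight-match-≤-size D t (p ++ i ∷ []) u u′ (args 0))
        (weight-matchArgs-≤-sizes D t p (suc i) us us′ (argsAt-tail {t = t} {p} args))

  matchNV-outside : ∀ D p (u t₂ : Term ar) → outside D₂ t₂ ≡ true → matchNV D D₂ p u t₂ ≡ ⊥S
  matchNV-outside D p u (fvar y) out with memb y D₂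
  ... | false = refl
  matchNV-outside D p u (bvar _) out = refl

  match-outside : ∀ D p (u t₂ : Term ar) → Scoped D 0 u → outside D₂ t₂ ≡ true → match D D₂ p u t₂ ≡ ⊥S
  match-outside D p (fvar z) t₂ (s-fvar z∈D) out rewrite ∈⇒memb z∈D | out = refl
  match-outside D p u@(sort _)  t₂ _ out = matchNV-outside D p u t₂ out
  match-outside D p u@(app _ _) t₂ _ out = matchNV-outside D p u t₂ out
  match-outside D p u@(lam _ _) t₂ _ out = matchNV-outside D p u t₂ out
  match-outside D p u@(pi _ _)  t₂ _ out = matchNV-outside D p u t₂ out
  match-outside D p u@(con _ _) t₂ _ out = matchNV-outside D p u t₂ out

  match-bvar-indep : ∀ D D′ p i (t₂ : Term ar) → match D D₂ p (bvar i) t₂ ≡ match D′ D₂ p (bvar i) t₂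
  match-bvar-indep D D′ p i (fvar _)  = refl
  match-bvar-indep D D′ p i (bvar _)  = refl
  match-bvar-indep D D′ p i (sort _)  = refl
  match-bvar-indep D D′ p i (app _ _) = refl
  match-bvar-indep D D′ p i (lam _ _) = refl
  match-bvar-indep D D′ p i (pi _ _)  = refl
  match-bvar-indep D D′ p i (con _ _) = refl

  match-sort-indep : ∀ D D′ p s (t₂ : Term ar) → match D D₂ p (sort s) t₂ ≡ match D′ D₂ p (sort s) t₂
  match-sort-indep D D′ p s (fvar _)  = refl
  match-sort-indep D D′ p s (bvar _)  = refl
  match-sort-indep D D′ p s (sort _)  = refl
  match-sort-indep D D′ p s (app _ _) = refl
  match-sort-indep D D′ p s (lam _ _) = refl
  match-sort-indep D D′ p s (pi _ _)  = refl
  match-sort-indep D D′ p s (con _ _) = refl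

  module _ (D₁ D′ : List ℕ) (γ : ℕ → Term ar) (γ-scoped : ∀ x → x ∈ D₁ → Scoped D′ 0 (γ x)) where

    mutual
      match-subst-≼ : ∀ {k} (t : Term ar) p t₁ t₂ → Scoped D₁ k t₁ → t at p ≡ just t₂ →
                      match D′ D₂ p (t₁ [ γ ]) t₂ ≼[ t ] match D₁ D₂ p t₁ t₂
      match-subst-≼ t p (fvar x) t₂ (s-fvar x∈D₁) at-p rewrite ∈⇒memb x∈D₁ with outside D₂ t₂ in out
      ... | true  = ≼-reflexive (match-outside D′ p (γ x) t₂ (γ-scoped x x∈D₁) out)
      ... | false = ≼-singleton t p at-p (weight-match-≤-size D′ t p (γ x) t₂ at-p)
      match-subst-≼ t p (bvar i) t₂ _ at-p = ≼-reflexive (match-bvar-indep D′ D₁ p i t₂)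
      match-subst-≼ t p (sort s) t₂ _ at-p = ≼-reflexive (match-sort-indep D′ D₁ p s t₂)
      match-subst-≼ t p (app a b) (app a′ b′) (s-app sa sb) at-p =
        ∪-mono-≼ (match-subst-≼ t (p ++ 1 ∷ []) a a′ sa (at-++-just t p (1 ∷ []) at-p refl))
                 (match-subst-≼ t (p ++ 2 ∷ []) b b′ sb (at-++-just t p (2 ∷ []) at-p refl))
      match-subst-≼ t p (lam a b) (lam a′ b′) (s-lam sa sb) at-p =
        ∪-mono-≼ (match-subst-≼ t (p ++ 1 ∷ []) a a′ sa (at-++-just t p (1 ∷ []) at-p refl))
                 (match-subst-≼ t (p ++ 2 ∷ []) b b′ sb (at-++-just t p (2 ∷ []) at-p refl))
      match-subst-≼ t p (pi a b) (pi a′ b′) (s-pi sa sb) at-p =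
        ∪-mono-≼ (match-subst-≼ t (p ++ 1 ∷ []) a a′ sa (at-++-just t p (1 ∷ []) at-p refl))
                 (match-subst-≼ t (p ++ 2 ∷ []) b b′ sb (at-++-just t p (2 ∷ []) at-p refl))
      match-subst-≼ t p (con h us) (con h′ us′) (s-con ss) at-p with h ≟ h′
      ... | yes refl = matchArgs-subst-≼ t p 1 us us′ ss (argsAt-con t p at-p)
      ... | no _     = ≼-refl
      match-subst-≼ t p (app _ _) (fvar _)  _ at-p = ≼-refl
      match-subst-≼ t p (app _ _) (bvar _)  _ at-p = ≼-refl
      match-subst-≼ t p (app _ _) (sort _)  _ at-p = ≼-refl
      match-subst-≼ t p (app _ _) (lam _ _) _ at-p = ≼-refl
      match-subst-≼ t p (app _ _) (pi _ _)  _ at-p = ≼-refl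
      match-subst-≼ t p (app _ _) (con _ _) _ at-p = ≼-refl
      match-subst-≼ t p (lam _ _) (fvar _)  _ at-p = ≼-refl
      match-subst-≼ t p (lam _ _) (bvar _)  _ at-p = ≼-refl
      match-subst-≼ t p (lam _ _) (sort _)  _ at-p = ≼-refl
      match-subst-≼ t p (lam _ _) (app _ _) _ at-p = ≼-refl
      match-subst-≼ t p (lam _ _) (pi _ _)  _ at-p = ≼-refl
      match-subst-≼ t p (lam _ _) (con _ _) _ at-p = ≼-refl
      match-subst-≼ t p (pi _ _)  (fvar _)  _ at-p = ≼-refl
      match-subst-≼ t p (pi _ _)  (bvar _)  _ at-p = ≼-refl
      match-subst-≼ t p (pi _ _)  (sort _)  _ at-p = ≼-refl
      match-subst-≼ t p (pi _ _)  (app _ _) _ at-p = ≼-refl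
      match-subst-≼ t p (pi _ _)  (lam _ _) _ at-p = ≼-refl
      match-subst-≼ t p (pi _ _)  (con _ _) _ at-p = ≼-refl
      match-subst-≼ t p (con _ _) (fvar _)  _ at-p = ≼-refl
      match-subst-≼ t p (con _ _) (bvar _)  _ at-p = ≼-refl
      match-subst-≼ t p (con _ _) (sort _)  _ at-p = ≼-refl
      match-subst-≼ t p (con _ _) (app _ _) _ at-p = ≼-refl
      match-subst-≼ t p (con _ _) (lam _ _) _ at-p = ≼-refl
      match-subst-≼ t p (con _ _) (pi _ _)  _ at-p = ≼-refl

      matchArgs-subst-≼ : ∀ {k} (t : Term ar) p i {n} (us us′ : Vec (Term ar) n) →
                          ScopedArgs D₁ k us → ArgsAt t p i us′ →
                          matchArgs D′ D₂ p i (substs us γ) us′ ≼[ t ] matchArgs D₁ D₂ p i us us′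
      matchArgs-subst-≼ t p i []       []         []       args = ≼-refl
      matchArgs-subst-≼ t p i (u ∷ us) (u′ ∷ us′) (s ∷ ss) args =
        ∪-mono-≼ (match-subst-≼ t (p ++ i ∷ []) u u′ s (args 0))
                 (matchArgs-subst-≼ t p (suc i) us us′ ss (argsAt-tail {t = t} {p} args))

-- Only t₁ needs to be well scoped.
lemma5p13 : {ar : ℕ → ℕ} (Δ₁ Δ₂ Δ' : Env ar) (t₁ t₂ : Term ar) →
    Δ₁ ⊢ t₁ → Δ₂ ⊢ t₂ →
    (γ : ℕ → Term ar) → IsSubst Δ₁ γ Δ' →
    (dist Δ' (t₁ [ γ ]) Δ₂ t₂ ≤ dist Δ₁ t₁ Δ₂ t₂)
    × (hasBot (matchΛ Δ₁ t₁ Δ₂ t₂) ≡ true →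
        (dist Δ' (t₁ [ γ ]) Δ₂ t₂ ≡ 0) × (dist Δ₁ t₁ Δ₂ t₂ ≡ 0))
lemma5p13 Δ₁ Δ₂ Δ' t₁ t₂ ⊢t₁ _ γ γ-scoped
  rewrite dist≡distOf Δ' (t₁ [ γ ]) Δ₂ t₂ | dist≡distOf Δ₁ t₁ Δ₂ t₂ =
  distOf-mono-≼ refines , λ ⊥∈S → distOf-⊥ (⊥-reflect refines ⊥∈S) , distOf-⊥ ⊥∈S
  where
    open _≼[_]_
    refines : matchΛ Δ' (t₁ [ γ ]) Δ₂ t₂ ≼[ t₂ ] matchΛ Δ₁ t₁ Δ₂ t₂
    refines = match-subst-≼ (dom Δ₂) (dom Δ₁) (dom Δ') γ γ-scoped t₂ [] t₁ t₂ ⊢t₁ refl
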